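{- For all integers $N\ge 1$ and $n\ge 0$, $$\sum_{i=0}^n\binom{n}{i}E_{N,i}E_{N,n-i}=\sum_{k=0}^n\binom{n}{k}\frac{2N-k}{2N}E_{N,k}\,\widehat E_{N-1,n-k}.$$
   Context: For an integer $N\ge 0$, the hypergeometric Euler numbers $E_{N,n}$ are defined by $\dfrac{1}{\sum_{m\ge 0}\frac{(2N)!}{(2N+2m)!}t^{2m}}=\sum_{n=0}^\infty E_{N,n}\frac{t^n}{n!}$ (the denominator equals ${}_1F_2(1;N+1,\tfrac{2N+1}{2};\tfrac{t^2}{4})$; equivalently $\sum_nE_{N,n}t^n/n!=\frac{t^{2N}/(2N)!}{\cosh t-\sum_{m=0}^{N-1}t^{2m}/(2m)!}$). For an integer $M\ge 0$, the complementary hypergeometric Euler numbers $\widehat E_{M,n}$ are defined by $$\frac{t^{2M+1}/(2M+1)!}{\sinh t-\sum_{m=0}^{M-1}t^{2m+1}/(2m+1)!}=\sum_{n=0}^\infty\widehat E_{M,n}\frac{t^n}{n!},$$ equivalently $1/\sum_{m\ge0}\frac{(2M+1)!}{(2M+2m+1)!}t^{2m}=\sum_n\widehat E_{M,n}t^n/n!$. -}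

module Defs where

open import Data.Nat as ℕ using (ℕ; zero; suc; _!; _∸_)
open import Data.Nat.Combinatorics using (_C_)
open import Data.Integer as ℤ using (ℤ; +_)
open import Data.Rational using (ℚ; _+_; _*_; _-_; -_; _/_; 0ℚ; 1ℚ)
open import Data.List using (List; []; _∷_; foldr; map; upTo; zipWith; head)
open import Data.Maybe using (fromMaybe)

ℕ→ℚ : ℕ → ℚ
ℕ→ℚ n = + n / 1

-- a / b for a b : ℕ, b ≥ 1 (only ever used with b ≥ 1)
_÷ℕ_ : ℕ → ℕ → ℚ
a ÷ℕ zero = 0ℚ
a ÷ℕ suc b = + a / suc b

∑≤ : ℕ → (ℕ → ℚ) → ℚ
∑≤ n f = foldr _+_ 0ℚ (map f (upTo (suc n)))

-- Reciprocal of a formal power series a(t) = ∑ a_n t^n with a_0 = 1: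
-- invList a n = [b_n , b_{n-1} , … , b_0] where ∑ b_n t^n = 1 / a(t),
-- i.e. b_0 = 1 and b_{n+1} = - ∑_{i=0}^{n} a_{i+1} b_{n-i}.
invList : (ℕ → ℚ) → ℕ → List ℚ
invList a zero = 1ℚ ∷ []
invList a (suc n) =
  let l = invList a n in
  (- foldr _+_ 0ℚ (zipWith _*_ (map (λ i → a (suc i)) (upTo (suc n))) l)) ∷ l

invCoeff : (ℕ → ℚ) → ℕ → ℚ
invCoeff a n = fromMaybe 0ℚ (head (invList a n))

-- coefficient of t^n in ∑_{m≥0} (2N)!/(2N+2m)! t^{2m}
hgSeriesE : ℕ → ℕ → ℚ
hgSeriesE N n with n ℕ.% 2
... | zero  = ((2 ℕ.* N) !) ÷ℕ ((2 ℕ.* N ℕ.+ n) !)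
... | suc _ = 0ℚ

-- coefficient of t^n in ∑_{m≥0} (2M+1)!/(2M+2m+1)! t^{2m}
hgSeriesÊ : ℕ → ℕ → ℚ
hgSeriesÊ M n with n ℕ.% 2
... | zero  = ((2 ℕ.* M ℕ.+ 1) !) ÷ℕ ((2 ℕ.* M ℕ.+ 1 ℕ.+ n) !)
... | suc _ = 0ℚ

-- hypergeometric Euler numbers E_{N,n}: 1/∑_m (2N)!/(2N+2m)! t^{2m} = ∑_n E_{N,n} t^n/n!
E : ℕ → ℕ → ℚ
E N n = ℕ→ℚ (n !) * invCoeff (hgSeriesE N) n

Ê : ℕ → ℕ → ℚ
Ê M n = ℕ→ℚ (n !) * invCoeff (hgSeriesÊ M) n

coeffFrac : ℕ → ℕ → ℚ
coeffFrac N k = (ℕ→ℚ (2 ℕ.* N) - ℕ→ℚ k) * (1 ÷ℕ (2 ℕ.* N))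

{-# OPTIONS --safe #-}
module Submission where

-- Let a(t) = ∑ₙ aₙ tⁿ be the series ∑ₘ (2N)!/(2N+2m)! t^{2m} and b = 1/a, so that
-- E_{N,n} = n! bₙ; likewise Ê_{N-1,n} = n! b̂ₙ with b̂ = 1/â. Coefficientwise
-- â = a + θa/(2N), where θ = t d/dt. Since θ(1/a) = -θa/a², this gives
-- b²â = b - θb/(2N), i.e. b² = (b - θb/(2N)) b̂, and n! times the n-th coefficient
-- of the two sides are the two sides of the identity.

open import Defs
open import Data.Nat as ℕ using (ℕ; zero; suc; NonZero; _<_; _≤_; s≤s; z≤n; _∸_; _!)
import Data.Nat.Properties as ℕ
open import Data.Nat.Combinatorics using (_C_; k![n∸k]!∣n!)
open import Data.Nat.Combinatorics.Specification using (nCk≡n!/k![n-k]!)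
open import Data.Nat.DivMod using (m/n*n≡m)
open import Data.Integer as ℤ using (+_)
import Data.Integer.Properties as ℤ
open import Data.Rational using (ℚ; _+_; _*_; _-_; -_; _/_; 0ℚ; 1ℚ; toℚᵘ)
open import Data.Rational.Properties
import Data.Rational.Unnormalised as ℚᵘ
import Data.Rational.Unnormalised.Properties as ℚᵘ
open import Data.Rational.Solver using (module +-*-Solver)
open import Data.List using (_∷_; foldr; map; upTo; zipWith; applyUpTo)
open import Relation.Binary.PropositionalEquality

open +-*-Solver

toℚᵘ-/suc : ∀ a d → toℚᵘ (+ a / suc d) ℚᵘ.≃ ℚᵘ.mkℚᵘ (+ a) d
toℚᵘ-/suc a d = toℚᵘ-fromℚᵘ (ℚᵘ.mkℚᵘ (+ a) d)

ℕ→ℚ-homo-+ : ∀ m n → ℕ→ℚ (m ℕ.+ n) ≡ ℕ→ℚ m + ℕ→ℚ n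
ℕ→ℚ-homo-+ m n = toℚᵘ-injective (ℚᵘ.≃-trans (toℚᵘ-/suc (m ℕ.+ n) 0)
  (ℚᵘ.≃-trans (ℚᵘ.*≡* cross) (ℚᵘ.≃-sym (ℚᵘ.≃-trans (toℚᵘ-homo-+ (ℕ→ℚ m) (ℕ→ℚ n))
    (ℚᵘ.+-cong (toℚᵘ-/suc m 0) (toℚᵘ-/suc n 0))))))
  where
  cross : + (m ℕ.+ n) ℤ.* + 1 ≡ (+ m ℤ.* + 1 ℤ.+ + n ℤ.* + 1) ℤ.* + 1
  cross = cong (ℤ._* + 1) (trans (ℤ.pos-+ m n)
    (sym (cong₂ ℤ._+_ (ℤ.*-identityʳ (+ m)) (ℤ.*-identityʳ (+ n)))))

ℕ→ℚ-homo-* : ∀ m n → ℕ→ℚ (m ℕ.* n) ≡ ℕ→ℚ m * ℕ→ℚ n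
ℕ→ℚ-homo-* m n = toℚᵘ-injective (ℚᵘ.≃-trans (toℚᵘ-/suc (m ℕ.* n) 0)
  (ℚᵘ.≃-trans (ℚᵘ.*≡* cross) (ℚᵘ.≃-sym (ℚᵘ.≃-trans (toℚᵘ-homo-* (ℕ→ℚ m) (ℕ→ℚ n))
    (ℚᵘ.*-cong (toℚᵘ-/suc m 0) (toℚᵘ-/suc n 0))))))
  where
  cross : + (m ℕ.* n) ℤ.* + 1 ≡ (+ m ℤ.* + n) ℤ.* + 1
  cross = cong (ℤ._* + 1) (ℤ.pos-* m n)

a÷b*b≡a : ∀ a b → .{{NonZero b}} → (a ÷ℕ b) * ℕ→ℚ b ≡ ℕ→ℚ a
a÷b*b≡a a (suc b) = toℚᵘ-injective (ℚᵘ.≃-trans (toℚᵘ-homo-* (a ÷ℕ suc b) (ℕ→ℚ (suc b)))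
  (ℚᵘ.≃-trans (ℚᵘ.*-cong (toℚᵘ-/suc a b) (toℚᵘ-/suc (suc b) 0))
  (ℚᵘ.≃-trans (ℚᵘ.*≡* cross) (ℚᵘ.≃-sym (toℚᵘ-/suc a 0)))))
  where
  cross : (+ a ℤ.* + suc b) ℤ.* + 1 ≡ + a ℤ.* + suc (b ℕ.* 1)
  cross = trans (ℤ.*-identityʳ _) (cong (λ x → + a ℤ.* + suc x) (sym (ℕ.*-identityʳ b)))

ℕ→ℚ-*-cancelʳ : ∀ b → .{{NonZero b}} → ∀ x y → x * ℕ→ℚ b ≡ y * ℕ→ℚ b → x ≡ y
ℕ→ℚ-*-cancelʳ b x y eq = begin
  x                        ≡⟨ solve 1 (λ x → x := x :* con 1ℚ) refl x ⟩
  x * 1ℚ                   ≡⟨ cong (x *_) (sym b⁻¹*b≡1) ⟩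
  x * (b⁻¹ * ℕ→ℚ b)        ≡⟨ solve 3 (λ x r B → x :* (r :* B) := (x :* B) :* r) refl x b⁻¹ (ℕ→ℚ b) ⟩
  (x * ℕ→ℚ b) * b⁻¹        ≡⟨ cong (_* b⁻¹) eq ⟩
  (y * ℕ→ℚ b) * b⁻¹        ≡⟨ solve 3 (λ y r B → (y :* B) :* r := y :* (r :* B)) refl y b⁻¹ (ℕ→ℚ b) ⟩
  y * (b⁻¹ * ℕ→ℚ b)        ≡⟨ cong (y *_) b⁻¹*b≡1 ⟩
  y * 1ℚ                   ≡⟨ solve 1 (λ y → y :* con 1ℚ := y) refl y ⟩
  y                        ∎
  where
  open ≡-Reasoning
  b⁻¹ = 1 ÷ℕ b
  b⁻¹*b≡1 : b⁻¹ * ℕ→ℚ b ≡ 1ℚ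
  b⁻¹*b≡1 = a÷b*b≡a 1 b

n÷n≡1 : ∀ n → .{{NonZero n}} → n ÷ℕ n ≡ 1ℚ
n÷n≡1 n = ℕ→ℚ-*-cancelʳ n _ _ (trans (a÷b*b≡a n n) (sym (*-identityˡ (ℕ→ℚ n))))

Series : Set
Series = ℕ → ℚ

shift : Series → Series
shift f i = f (suc i)

infixl 7 _⋆_

_⋆_ : Series → Series → Series
(f ⋆ g) zero    = f 0 * g 0
(f ⋆ g) (suc n) = f 0 * g (suc n) + (shift f ⋆ g) n

δ : Series
δ zero    = 1ℚ
δ (suc _) = 0ℚ

θ : Series → Series
θ f n = ℕ→ℚ n * f n

∑< : ℕ → (ℕ → ℚ) → ℚ
∑< zero    f = 0ℚ
∑< (suc m) f = f 0 + ∑< m (shift f)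

∑<-cong : ∀ m {f g} → (∀ i → i < m → f i ≡ g i) → ∑< m f ≡ ∑< m g
∑<-cong zero    f≡g = refl
∑<-cong (suc m) f≡g = cong₂ _+_ (f≡g 0 (s≤s z≤n)) (∑<-cong m (λ i i<m → f≡g (suc i) (s≤s i<m)))

∑<-last : ∀ m f → ∑< (suc m) f ≡ ∑< m f + f m
∑<-last zero    f = trans (+-identityʳ (f 0)) (sym (+-identityˡ (f 0)))
∑<-last (suc m) f = trans (cong (_+_ (f 0)) (∑<-last m (shift f)))
                          (sym (+-assoc (f 0) (∑< m (shift f)) (f (suc m))))

∑<-reverse : ∀ m f → ∑< m f ≡ ∑< m (λ i → f (m ∸ suc i))
∑<-reverse zero    f = refl
∑<-reverse (suc m) f = begin
  f 0 + ∑< m (shift f)                 ≡⟨ cong (_+_ (f 0)) (∑<-reverse m (shift f)) ⟩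
  f 0 + ∑< m (λ i → f (suc (m ∸ suc i))) ≡⟨ cong (_+_ (f 0)) (∑<-cong m (λ i i<m → cong f (sym (ℕ.+-∸-assoc 1 i<m)))) ⟩
  f 0 + ∑< m (λ i → f (m ∸ i))         ≡⟨ +-comm (f 0) _ ⟩
  ∑< m (λ i → f (m ∸ i)) + f 0         ≡⟨ cong (λ k → ∑< m (λ i → f (m ∸ i)) + f k) (sym (ℕ.n∸n≡0 m)) ⟩
  ∑< m (λ i → f (m ∸ i)) + f (m ∸ m)   ≡⟨ ∑<-last m (λ i → f (m ∸ i)) ⟨
  ∑< (suc m) (λ i → f (m ∸ i))         ∎
  where open ≡-Reasoning

*-distribˡ-∑< : ∀ c m f → c * ∑< m f ≡ ∑< m (λ i → c * f i)
*-distribˡ-∑< c zero    f = *-zeroʳ c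
*-distribˡ-∑< c (suc m) f = trans (*-distribˡ-+ c (f 0) (∑< m (shift f)))
                                  (cong (_+_ (c * f 0)) (*-distribˡ-∑< c m (shift f)))

foldr-map-applyUpTo : ∀ (f : ℕ → ℚ) (g : ℕ → ℕ) m → foldr _+_ 0ℚ (map f (applyUpTo g m)) ≡ ∑< m (λ i → f (g i))
foldr-map-applyUpTo f g zero    = refl
foldr-map-applyUpTo f g (suc m) = cong (_+_ (f (g 0))) (foldr-map-applyUpTo f (λ i → g (suc i)) m)

foldr-zipWith-applyUpTo : ∀ (f : ℕ → ℚ) (g : ℕ → ℕ) (h : ℕ → ℚ) m →
  foldr _+_ 0ℚ (zipWith _*_ (map f (applyUpTo g m)) (applyUpTo h m)) ≡ ∑< m (λ i → f (g i) * h i)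
foldr-zipWith-applyUpTo f g h zero    = refl
foldr-zipWith-applyUpTo f g h (suc m) =
  cong (_+_ (f (g 0) * h 0)) (foldr-zipWith-applyUpTo f (λ i → g (suc i)) (λ i → h (suc i)) m)

∑≤≡∑< : ∀ n f → ∑≤ n f ≡ ∑< (suc n) f
∑≤≡∑< n f = foldr-map-applyUpTo f (λ i → i) (suc n)

∑≤-cong : ∀ n {f g} → (∀ i → f i ≡ g i) → ∑≤ n f ≡ ∑≤ n g
∑≤-cong n {f} {g} f≡g = begin
  ∑≤ n f       ≡⟨ ∑≤≡∑< n f ⟩
  ∑< (suc n) f ≡⟨ ∑<-cong (suc n) (λ i _ → f≡g i) ⟩
  ∑< (suc n) g ≡⟨ ∑≤≡∑< n g ⟨
  ∑≤ n g       ∎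
  where open ≡-Reasoning

⋆≡∑< : ∀ f g n → (f ⋆ g) n ≡ ∑< (suc n) (λ i → f i * g (n ∸ i))
⋆≡∑< f g zero    = sym (+-identityʳ _)
⋆≡∑< f g (suc n) = cong (_+_ (f 0 * g (suc n))) (⋆≡∑< (shift f) g n)

⋆-cong : ∀ {f f′ g g′} → (∀ i → f i ≡ f′ i) → (∀ i → g i ≡ g′ i) → ∀ n → (f ⋆ g) n ≡ (f′ ⋆ g′) n
⋆-cong f≡f′ g≡g′ zero    = cong₂ _*_ (f≡f′ 0) (g≡g′ 0)
⋆-cong f≡f′ g≡g′ (suc n) = cong₂ _+_ (cong₂ _*_ (f≡f′ 0) (g≡g′ (suc n))) (⋆-cong (λ i → f≡f′ (suc i)) g≡g′ n)

⋆-congˡ : ∀ {f f′} g → (∀ i → f i ≡ f′ i) → ∀ n → (f ⋆ g) n ≡ (f′ ⋆ g) n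
⋆-congˡ g f≡f′ = ⋆-cong f≡f′ (λ _ → refl)

⋆-congʳ : ∀ f {g g′} → (∀ i → g i ≡ g′ i) → ∀ n → (f ⋆ g) n ≡ (f ⋆ g′) n
⋆-congʳ f = ⋆-cong (λ _ → refl)

⋆-distribʳ-+ : ∀ f g h n → ((λ i → f i + g i) ⋆ h) n ≡ (f ⋆ h) n + (g ⋆ h) n
⋆-distribʳ-+ f g h zero    = *-distribʳ-+ (h 0) (f 0) (g 0)
⋆-distribʳ-+ f g h (suc n) = begin
  (f 0 + g 0) * h (suc n) + ((λ i → f (suc i) + g (suc i)) ⋆ h) n
    ≡⟨ cong (_+_ ((f 0 + g 0) * h (suc n))) (⋆-distribʳ-+ (shift f) (shift g) h n) ⟩
  (f 0 + g 0) * h (suc n) + ((shift f ⋆ h) n + (shift g ⋆ h) n)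
    ≡⟨ solve 5 (λ a b c x y → (a :+ b) :* c :+ (x :+ y) := (a :* c :+ x) :+ (b :* c :+ y))
         refl (f 0) (g 0) (h (suc n)) ((shift f ⋆ h) n) ((shift g ⋆ h) n) ⟩
  (f ⋆ h) (suc n) + (g ⋆ h) (suc n) ∎
  where open ≡-Reasoning

⋆-*ˡ : ∀ c f h n → ((λ i → c * f i) ⋆ h) n ≡ c * (f ⋆ h) n
⋆-*ˡ c f h zero    = *-assoc c (f 0) (h 0)
⋆-*ˡ c f h (suc n) = begin
  c * f 0 * h (suc n) + ((λ i → c * f (suc i)) ⋆ h) n
    ≡⟨ cong (_+_ (c * f 0 * h (suc n))) (⋆-*ˡ c (shift f) h n) ⟩
  c * f 0 * h (suc n) + c * (shift f ⋆ h) n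
    ≡⟨ solve 4 (λ c a b x → c :* a :* b :+ c :* x := c :* (a :* b :+ x)) refl c (f 0) (h (suc n)) ((shift f ⋆ h) n) ⟩
  c * (f ⋆ h) (suc n) ∎
  where open ≡-Reasoning

⋆-negˡ : ∀ f h n → ((λ i → - f i) ⋆ h) n ≡ - (f ⋆ h) n
⋆-negˡ f h n = begin
  ((λ i → - f i) ⋆ h) n          ≡⟨ ⋆-congˡ h (λ i → neg≡-1* (f i)) n ⟩
  ((λ i → - 1ℚ * f i) ⋆ h) n     ≡⟨ ⋆-*ˡ (- 1ℚ) f h n ⟩
  - 1ℚ * (f ⋆ h) n               ≡⟨ neg≡-1* ((f ⋆ h) n) ⟨
  - (f ⋆ h) n                    ∎
  where
  open ≡-Reasoning
  neg≡-1* : ∀ x → - x ≡ - 1ℚ * x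
  neg≡-1* = solve 1 (λ x → :- x := (:- con 1ℚ) :* x) refl

⋆-zeroˡ : ∀ g n → ((λ _ → 0ℚ) ⋆ g) n ≡ 0ℚ
⋆-zeroˡ g zero    = *-zeroˡ (g 0)
⋆-zeroˡ g (suc n) = trans (cong₂ _+_ (*-zeroˡ (g (suc n))) (⋆-zeroˡ g n)) (+-identityˡ 0ℚ)

⋆-identityˡ : ∀ g n → (δ ⋆ g) n ≡ g n
⋆-identityˡ g zero    = *-identityˡ (g 0)
⋆-identityˡ g (suc n) = trans (cong₂ _+_ (*-identityˡ (g (suc n))) (⋆-zeroˡ g n)) (+-identityʳ (g (suc n)))

⋆-assoc : ∀ f g h n → (f ⋆ g ⋆ h) n ≡ (f ⋆ (g ⋆ h)) n
⋆-assoc f g h zero    = *-assoc (f 0) (g 0) (h 0)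
⋆-assoc f g h (suc n) = begin
  f 0 * g 0 * h (suc n) + ((λ m → f 0 * g (suc m) + (shift f ⋆ g) m) ⋆ h) n
    ≡⟨ cong (_+_ (f 0 * g 0 * h (suc n))) (⋆-distribʳ-+ (λ m → f 0 * g (suc m)) (shift f ⋆ g) h n) ⟩
  f 0 * g 0 * h (suc n) + (((λ m → f 0 * g (suc m)) ⋆ h) n + (shift f ⋆ g ⋆ h) n)
    ≡⟨ cong₂ (λ u v → f 0 * g 0 * h (suc n) + (u + v)) (⋆-*ˡ (f 0) (shift g) h n) (⋆-assoc (shift f) g h n) ⟩
  f 0 * g 0 * h (suc n) + (f 0 * (shift g ⋆ h) n + (shift f ⋆ (g ⋆ h)) n)
    ≡⟨ solve 5 (λ a b c x y → (a :* b) :* c :+ (a :* x :+ y) := a :* (b :* c :+ x) :+ y)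
         refl (f 0) (g 0) (h (suc n)) ((shift g ⋆ h) n) ((shift f ⋆ (g ⋆ h)) n) ⟩
  (f ⋆ (g ⋆ h)) (suc n) ∎
  where open ≡-Reasoning

⋆-comm : ∀ f g n → (f ⋆ g) n ≡ (g ⋆ f) n
⋆-comm f g n = begin
  (f ⋆ g) n                                   ≡⟨ ⋆≡∑< f g n ⟩
  ∑< (suc n) (λ i → f i * g (n ∸ i))           ≡⟨ ∑<-reverse (suc n) (λ i → f i * g (n ∸ i)) ⟩
  ∑< (suc n) (λ i → f (n ∸ i) * g (n ∸ (n ∸ i))) ≡⟨ ∑<-cong (suc n) swap ⟩
  ∑< (suc n) (λ i → g i * f (n ∸ i))           ≡⟨ ⋆≡∑< g f n ⟨
  (g ⋆ f) n                                   ∎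
  where
  open ≡-Reasoning
  swap : ∀ i → i < suc n → f (n ∸ i) * g (n ∸ (n ∸ i)) ≡ g i * f (n ∸ i)
  swap i i<1+n = trans (cong (λ k → f (n ∸ i) * g k) (ℕ.m∸[m∸n]≡n (ℕ.≤-pred i<1+n)))
                       (*-comm (f (n ∸ i)) (g i))

invList≡applyUpTo : ∀ a n → invList a n ≡ applyUpTo (λ i → invCoeff a (n ∸ i)) (suc n)
invList≡applyUpTo a zero    = refl
invList≡applyUpTo a (suc n) = cong (invCoeff a (suc n) ∷_) (invList≡applyUpTo a n)

invCoeff-suc : ∀ a n → invCoeff a (suc n) ≡ - (shift a ⋆ invCoeff a) n
invCoeff-suc a n = cong -_ (begin
  foldr _+_ 0ℚ (zipWith _*_ (map (shift a) (upTo (suc n))) (invList a n))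
    ≡⟨ cong (λ l → foldr _+_ 0ℚ (zipWith _*_ (map (shift a) (upTo (suc n))) l)) (invList≡applyUpTo a n) ⟩
  foldr _+_ 0ℚ (zipWith _*_ (map (shift a) (upTo (suc n))) (applyUpTo (λ i → invCoeff a (n ∸ i)) (suc n)))
    ≡⟨ foldr-zipWith-applyUpTo (shift a) (λ i → i) (λ i → invCoeff a (n ∸ i)) (suc n) ⟩
  ∑< (suc n) (λ i → shift a i * invCoeff a (n ∸ i))
    ≡⟨ ⋆≡∑< (shift a) (invCoeff a) n ⟨
  (shift a ⋆ invCoeff a) n ∎)
  where open ≡-Reasoning

a⋆invCoeff-a≡δ : ∀ a → a 0 ≡ 1ℚ → ∀ n → (a ⋆ invCoeff a) n ≡ δ n
a⋆invCoeff-a≡δ a a₀≡1 zero    = cong (_* 1ℚ) a₀≡1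
a⋆invCoeff-a≡δ a a₀≡1 (suc n) = begin
  a 0 * invCoeff a (suc n) + X ≡⟨ cong₂ (λ u v → u * v + X) a₀≡1 (invCoeff-suc a n) ⟩
  1ℚ * - X + X                 ≡⟨ solve 1 (λ X → con 1ℚ :* (:- X) :+ X := con 0ℚ) refl X ⟩
  0ℚ                           ∎
  where
  open ≡-Reasoning
  X = (shift a ⋆ invCoeff a) n

shift-θ : ∀ f i → shift (θ f) i ≡ shift f i + θ (shift f) i
shift-θ f i = begin
  ℕ→ℚ (suc i) * f (suc i)           ≡⟨ cong (_* f (suc i)) (ℕ→ℚ-homo-+ 1 i) ⟩
  (1ℚ + ℕ→ℚ i) * f (suc i)          ≡⟨ solve 2 (λ x m → (con 1ℚ :+ m) :* x := x :+ m :* x) refl (f (suc i)) (ℕ→ℚ i) ⟩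
  f (suc i) + ℕ→ℚ i * f (suc i)     ∎
  where open ≡-Reasoning

θ-⋆ : ∀ f g n → θ (f ⋆ g) n ≡ (θ f ⋆ g) n + (f ⋆ θ g) n
θ-⋆ f g zero = begin
  0ℚ * (f 0 * g 0)                  ≡⟨ solve 2 (λ a b → con 0ℚ :* (a :* b) := con 0ℚ :* a :* b :+ a :* (con 0ℚ :* b)) refl (f 0) (g 0) ⟩
  0ℚ * f 0 * g 0 + f 0 * (0ℚ * g 0) ∎
  where open ≡-Reasoning
θ-⋆ f g (suc n) = begin
  S * (f 0 * g (suc n) + X)
    ≡⟨ solve 4 (λ S a b X → S :* (a :* b :+ X) := con 0ℚ :* a :* b :+ a :* (S :* b) :+ S :* X)
         refl S (f 0) (g (suc n)) X ⟩
  0ℚ * f 0 * g (suc n) + f 0 * (S * g (suc n)) + S * X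
    ≡⟨ cong (_+_ (0ℚ * f 0 * g (suc n) + f 0 * (S * g (suc n)))) S*X≡X+Y+Z ⟩
  0ℚ * f 0 * g (suc n) + f 0 * (S * g (suc n)) + (X + (Y + Z))
    ≡⟨ solve 5 (λ p q X Y Z → p :+ q :+ (X :+ (Y :+ Z)) := (p :+ (X :+ Y)) :+ (q :+ Z))
         refl (0ℚ * f 0 * g (suc n)) (f 0 * (S * g (suc n))) X Y Z ⟩
  0ℚ * f 0 * g (suc n) + (X + Y) + (f 0 * (S * g (suc n)) + Z)
    ≡⟨ cong (λ t → 0ℚ * f 0 * g (suc n) + t + (f 0 * (S * g (suc n)) + Z)) X+Y≡shift-θf⋆g ⟩
  (θ f ⋆ g) (suc n) + (f ⋆ θ g) (suc n) ∎
  where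
  open ≡-Reasoning
  S = ℕ→ℚ (suc n)
  X = (shift f ⋆ g) n
  Y = (θ (shift f) ⋆ g) n
  Z = (shift f ⋆ θ g) n
  S*X≡X+Y+Z : S * X ≡ X + (Y + Z)
  S*X≡X+Y+Z = begin
    S * X               ≡⟨ cong (_* X) (ℕ→ℚ-homo-+ 1 n) ⟩
    (1ℚ + ℕ→ℚ n) * X    ≡⟨ solve 2 (λ X m → (con 1ℚ :+ m) :* X := X :+ m :* X) refl X (ℕ→ℚ n) ⟩
    X + ℕ→ℚ n * X       ≡⟨ cong (_+_ X) (θ-⋆ (shift f) g n) ⟩
    X + (Y + Z)         ∎
  X+Y≡shift-θf⋆g : X + Y ≡ (shift (θ f) ⋆ g) n
  X+Y≡shift-θf⋆g = trans (sym (⋆-distribʳ-+ (shift f) (θ (shift f)) g n))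
                         (⋆-congˡ g (λ i → sym (shift-θ f i)) n)

module Inverse {a b : Series} (a⋆b≡δ : ∀ n → (a ⋆ b) n ≡ δ n) where

  a⋆[b⋆f]≡f : ∀ f n → (a ⋆ (b ⋆ f)) n ≡ f n
  a⋆[b⋆f]≡f f n = begin
    (a ⋆ (b ⋆ f)) n ≡⟨ ⋆-assoc a b f n ⟨
    (a ⋆ b ⋆ f) n   ≡⟨ ⋆-congˡ f a⋆b≡δ n ⟩
    (δ ⋆ f) n       ≡⟨ ⋆-identityˡ f n ⟩
    f n             ∎
    where open ≡-Reasoning

  θa⋆b≡-a⋆θb : ∀ n → (θ a ⋆ b) n ≡ - (a ⋆ θ b) n
  θa⋆b≡-a⋆θb n = begin
    x               ≡⟨ solve 2 (λ x y → x := (x :+ y) :- y) refl x y ⟩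
    (x + y) - y     ≡⟨ cong (_- y) (θ-⋆ a b n) ⟨
    θ (a ⋆ b) n - y ≡⟨ cong (λ t → ℕ→ℚ n * t - y) (a⋆b≡δ n) ⟩
    θ δ n - y       ≡⟨ cong (_- y) (θδ≡0 n) ⟩
    0ℚ - y          ≡⟨ +-identityˡ (- y) ⟩
    - y             ∎
    where
    open ≡-Reasoning
    x = (θ a ⋆ b) n
    y = (a ⋆ θ b) n
    θδ≡0 : ∀ n → θ δ n ≡ 0ℚ
    θδ≡0 zero    = refl
    θδ≡0 (suc n) = *-zeroʳ (ℕ→ℚ (suc n))

  θa⋆b²≡-θb : ∀ n → (θ a ⋆ (b ⋆ b)) n ≡ - θ b n
  θa⋆b²≡-θb n = begin
    (θ a ⋆ (b ⋆ b)) n             ≡⟨ ⋆-assoc (θ a) b b n ⟨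
    (θ a ⋆ b ⋆ b) n               ≡⟨ ⋆-congˡ b θa⋆b≡-a⋆θb n ⟩
    ((λ i → - (a ⋆ θ b) i) ⋆ b) n ≡⟨ ⋆-negˡ (a ⋆ θ b) b n ⟩
    - (a ⋆ θ b ⋆ b) n             ≡⟨ cong -_ (⋆-assoc a (θ b) b n) ⟩
    - (a ⋆ (θ b ⋆ b)) n           ≡⟨ cong -_ (⋆-congʳ a (⋆-comm (θ b) b) n) ⟩
    - (a ⋆ (b ⋆ θ b)) n           ≡⟨ cong -_ (a⋆[b⋆f]≡f (θ b) n) ⟩
    - θ b n                       ∎
    where open ≡-Reasoning

  b²≡[b-cθb]⋆b̂ : ∀ {â b̂} c → (∀ n → â n ≡ a n + c * θ a n) → (∀ n → (â ⋆ b̂) n ≡ δ n) →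
                 ∀ n → (b ⋆ b) n ≡ ((λ k → b k - c * θ b k) ⋆ b̂) n
  b²≡[b-cθb]⋆b̂ {â} {b̂} c â≡a+cθa â⋆b̂≡δ n = begin
    (b ⋆ b) n                         ≡⟨ ⋆-identityˡ (b ⋆ b) n ⟨
    (δ ⋆ (b ⋆ b)) n                   ≡⟨ ⋆-comm δ (b ⋆ b) n ⟩
    ((b ⋆ b) ⋆ δ) n                   ≡⟨ ⋆-congʳ (b ⋆ b) â⋆b̂≡δ n ⟨
    ((b ⋆ b) ⋆ (â ⋆ b̂)) n             ≡⟨ ⋆-assoc (b ⋆ b) â b̂ n ⟨
    ((b ⋆ b) ⋆ â ⋆ b̂) n               ≡⟨ ⋆-congˡ b̂ (⋆-comm (b ⋆ b) â) n ⟩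
    (â ⋆ (b ⋆ b) ⋆ b̂) n               ≡⟨ ⋆-congˡ b̂ â⋆b²≡b-cθb n ⟩
    ((λ k → b k - c * θ b k) ⋆ b̂) n   ∎
    where
    open ≡-Reasoning
    â⋆b²≡b-cθb : ∀ k → (â ⋆ (b ⋆ b)) k ≡ b k - c * θ b k
    â⋆b²≡b-cθb k = begin
      (â ⋆ (b ⋆ b)) k                                               ≡⟨ ⋆-congˡ (b ⋆ b) â≡a+cθa k ⟩
      ((λ i → a i + c * θ a i) ⋆ (b ⋆ b)) k                         ≡⟨ ⋆-distribʳ-+ a (λ i → c * θ a i) (b ⋆ b) k ⟩
      (a ⋆ (b ⋆ b)) k + ((λ i → c * θ a i) ⋆ (b ⋆ b)) k             ≡⟨ cong₂ _+_ (a⋆[b⋆f]≡f b k) (⋆-*ˡ c (θ a) (b ⋆ b) k) ⟩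
      b k + c * (θ a ⋆ (b ⋆ b)) k                                   ≡⟨ cong (λ t → b k + c * t) (θa⋆b²≡-θb k) ⟩
      b k + c * - θ b k                                             ≡⟨ solve 3 (λ x c y → x :+ c :* (:- y) := x :- c :* y) refl (b k) c (θ b k) ⟩
      b k - c * θ b k                                               ∎

factorialRatio : ℕ → ℕ → ℚ
factorialRatio K n = (K !) ÷ℕ ((K ℕ.+ n) !)

factorialRatio-*-suc : ∀ K n → factorialRatio K n * ℕ→ℚ (suc K) ≡ factorialRatio (suc K) n * ℕ→ℚ (suc K ℕ.+ n)
factorialRatio-*-suc K n = ℕ→ℚ-*-cancelʳ ((K ℕ.+ n) !) _ _ (trans lhs≡[1+K]! (sym rhs≡[1+K]!))
  where
  open ≡-Reasoning
  instance _ = (K ℕ.+ n) ℕ.!≢0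
  instance _ = (suc K ℕ.+ n) ℕ.!≢0
  r  = factorialRatio K n
  r′ = factorialRatio (suc K) n
  S  = ℕ→ℚ (suc K)
  Q  = ℕ→ℚ ((K ℕ.+ n) !)
  lhs≡[1+K]! : r * S * Q ≡ ℕ→ℚ (suc K !)
  lhs≡[1+K]! = begin
    r * S * Q          ≡⟨ solve 3 (λ r S Q → r :* S :* Q := r :* Q :* S) refl r S Q ⟩
    r * Q * S          ≡⟨ cong (_* S) (a÷b*b≡a (K !) ((K ℕ.+ n) !)) ⟩
    ℕ→ℚ (K !) * S      ≡⟨ *-comm (ℕ→ℚ (K !)) S ⟩
    S * ℕ→ℚ (K !)      ≡⟨ ℕ→ℚ-homo-* (suc K) (K !) ⟨
    ℕ→ℚ (suc K !)      ∎
  rhs≡[1+K]! : r′ * ℕ→ℚ (suc K ℕ.+ n) * Q ≡ ℕ→ℚ (suc K !)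
  rhs≡[1+K]! = begin
    r′ * ℕ→ℚ (suc K ℕ.+ n) * Q     ≡⟨ *-assoc r′ _ Q ⟩
    r′ * (ℕ→ℚ (suc K ℕ.+ n) * Q)   ≡⟨ cong (r′ *_) (ℕ→ℚ-homo-* (suc K ℕ.+ n) ((K ℕ.+ n) !)) ⟨
    r′ * ℕ→ℚ ((suc K ℕ.+ n) !)     ≡⟨ a÷b*b≡a (suc K !) ((suc K ℕ.+ n) !) ⟩
    ℕ→ℚ (suc K !)                  ∎

factorialRatio-suc : ∀ K n → factorialRatio K n ≡ factorialRatio (suc K) n + (1 ÷ℕ suc K) * θ (factorialRatio (suc K)) n
factorialRatio-suc K n = ℕ→ℚ-*-cancelʳ (suc K) _ _ (begin
  factorialRatio K n * S        ≡⟨ factorialRatio-*-suc K n ⟩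
  r′ * ℕ→ℚ (suc K ℕ.+ n)        ≡⟨ cong (r′ *_) (ℕ→ℚ-homo-+ (suc K) n) ⟩
  r′ * (S + ℕ→ℚ n)              ≡⟨ solve 3 (λ r S m → r :* (S :+ m) := r :* S :+ con 1ℚ :* (m :* r)) refl r′ S (ℕ→ℚ n) ⟩
  r′ * S + 1ℚ * θr′             ≡⟨ cong (λ t → r′ * S + t * θr′) (a÷b*b≡a 1 (suc K)) ⟨
  r′ * S + (c * S) * θr′        ≡⟨ solve 4 (λ r S c t → r :* S :+ (c :* S) :* t := (r :+ c :* t) :* S) refl r′ S c θr′ ⟩
  (r′ + c * θr′) * S            ∎)
  where
  open ≡-Reasoning
  r′  = factorialRatio (suc K) n
  θr′ = θ (factorialRatio (suc K)) n
  S   = ℕ→ℚ (suc K)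
  c   = 1 ÷ℕ suc K

factorialRatio-0 : ∀ K → factorialRatio K 0 ≡ 1ℚ
factorialRatio-0 K = trans (cong (λ x → (K !) ÷ℕ (x !)) (ℕ.+-identityʳ K)) (n÷n≡1 (K !) {{K ℕ.!≢0}})

hgSeriesÊ≡hgSeriesE+θ : ∀ M n →
  hgSeriesÊ M n ≡ hgSeriesE (suc M) n + (1 ÷ℕ (2 ℕ.* suc M)) * θ (hgSeriesE (suc M)) n
hgSeriesÊ≡hgSeriesE+θ M n with n ℕ.% 2
... | zero  = subst (λ L → factorialRatio K n ≡ factorialRatio L n + (1 ÷ℕ L) * θ (factorialRatio L) n)
                    (sym 2[1+M]≡1+K) (factorialRatio-suc K n)
  where
  K = 2 ℕ.* M ℕ.+ 1
  2[1+M]≡1+K : 2 ℕ.* suc M ≡ suc K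
  2[1+M]≡1+K = trans (ℕ.*-suc 2 M) (cong suc (ℕ.+-comm 1 (2 ℕ.* M)))
... | suc _ = solve 2 (λ c m → con 0ℚ := con 0ℚ :+ c :* (m :* con 0ℚ)) refl (1 ÷ℕ (2 ℕ.* suc M)) (ℕ→ℚ n)

coeffFrac-* : ∀ N k x → .{{NonZero N}} → coeffFrac N k * x ≡ x - (1 ÷ℕ (2 ℕ.* N)) * (ℕ→ℚ k * x)
coeffFrac-* N k x = begin
  (T - ℕ→ℚ k) * c * x         ≡⟨ solve 4 (λ T k c x → (T :- k) :* c :* x := (c :* T) :* x :- c :* (k :* x)) refl T (ℕ→ℚ k) c x ⟩
  (c * T) * x - c * (ℕ→ℚ k * x) ≡⟨ cong (λ t → t * x - c * (ℕ→ℚ k * x)) (a÷b*b≡a 1 (2 ℕ.* N) {{2N≢0}}) ⟩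
  1ℚ * x - c * (ℕ→ℚ k * x)     ≡⟨ cong (_- c * (ℕ→ℚ k * x)) (*-identityˡ x) ⟩
  x - c * (ℕ→ℚ k * x)          ∎
  where
  open ≡-Reasoning
  T = ℕ→ℚ (2 ℕ.* N)
  c = 1 ÷ℕ (2 ℕ.* N)
  2N≢0 : NonZero (2 ℕ.* N)
  2N≢0 = ℕ.m*n≢0 2 N

binomial-ℚ : ∀ n i → i ≤ n → ℕ→ℚ (n C i) * ℕ→ℚ (i !) * ℕ→ℚ ((n ∸ i) !) ≡ ℕ→ℚ (n !)
binomial-ℚ n i i≤n = begin
  ℕ→ℚ (n C i) * ℕ→ℚ (i !) * ℕ→ℚ ((n ∸ i) !)     ≡⟨ *-assoc (ℕ→ℚ (n C i)) _ _ ⟩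
  ℕ→ℚ (n C i) * (ℕ→ℚ (i !) * ℕ→ℚ ((n ∸ i) !))   ≡⟨ cong (ℕ→ℚ (n C i) *_) (ℕ→ℚ-homo-* (i !) ((n ∸ i) !)) ⟨
  ℕ→ℚ (n C i) * ℕ→ℚ (i ! ℕ.* (n ∸ i) !)         ≡⟨ ℕ→ℚ-homo-* (n C i) _ ⟨
  ℕ→ℚ ((n C i) ℕ.* (i ! ℕ.* (n ∸ i) !))           ≡⟨ cong ℕ→ℚ nCi*i!*[n-i]!≡n! ⟩
  ℕ→ℚ (n !)                                     ∎
  where
  open ≡-Reasoning
  nCi*i!*[n-i]!≡n! : (n C i) ℕ.* (i ! ℕ.* (n ∸ i) !) ≡ n !
  nCi*i!*[n-i]!≡n! = trans (cong (ℕ._* (i ! ℕ.* (n ∸ i) !)) (nCk≡n!/k![n-k]! i≤n))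
                           (m/n*n≡m {{i ℕ.!* (n ∸ i) !≢0}} (k![n∸k]!∣n! i≤n))

egf-⋆ : ∀ x y n →
  ∑≤ n (λ i → ℕ→ℚ (n C i) * (ℕ→ℚ (i !) * x i) * (ℕ→ℚ ((n ∸ i) !) * y (n ∸ i))) ≡ ℕ→ℚ (n !) * (x ⋆ y) n
egf-⋆ x y n = begin
  ∑≤ n term                                           ≡⟨ ∑≤≡∑< n term ⟩
  ∑< (suc n) term                                     ≡⟨ ∑<-cong (suc n) term≡ ⟩
  ∑< (suc n) (λ i → ℕ→ℚ (n !) * (x i * y (n ∸ i)))   ≡⟨ *-distribˡ-∑< (ℕ→ℚ (n !)) (suc n) (λ i → x i * y (n ∸ i)) ⟨
  ℕ→ℚ (n !) * ∑< (suc n) (λ i → x i * y (n ∸ i))     ≡⟨ cong (ℕ→ℚ (n !) *_) (⋆≡∑< x y n) ⟨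
  ℕ→ℚ (n !) * (x ⋆ y) n                               ∎
  where
  open ≡-Reasoning
  term : ℕ → ℚ
  term i = ℕ→ℚ (n C i) * (ℕ→ℚ (i !) * x i) * (ℕ→ℚ ((n ∸ i) !) * y (n ∸ i))
  term≡ : ∀ i → i < suc n → term i ≡ ℕ→ℚ (n !) * (x i * y (n ∸ i))
  term≡ i i<1+n = trans
    (solve 5 (λ C I J u v → C :* (I :* u) :* (J :* v) := (C :* I :* J) :* (u :* v)) refl
       (ℕ→ℚ (n C i)) (ℕ→ℚ (i !)) (ℕ→ℚ ((n ∸ i) !)) (x i) (y (n ∸ i)))
    (cong (_* (x i * y (n ∸ i))) (binomial-ℚ n i (ℕ.≤-pred i<1+n)))

theorem3 : (N n : ℕ) → 1 ≤ N →
    ∑≤ n (λ i → ℕ→ℚ (n C i) * E N i * E N (n ∸ i))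
      ≡ ∑≤ n (λ k → ℕ→ℚ (n C k) * coeffFrac N k * E N k * Ê (N ∸ 1) (n ∸ k))
theorem3 N@(suc M) n _ = begin
  ∑≤ n (λ i → ℕ→ℚ (n C i) * E N i * E N (n ∸ i))                  ≡⟨ egf-⋆ b b n ⟩
  ℕ→ℚ (n !) * (b ⋆ b) n                                           ≡⟨ cong (ℕ→ℚ (n !) *_) b²≡D⋆b̂ ⟩
  ℕ→ℚ (n !) * (D ⋆ b̂) n                                           ≡⟨ egf-⋆ D b̂ n ⟨
  ∑≤ n (λ k → ℕ→ℚ (n C k) * (ℕ→ℚ (k !) * D k) * Ê M (n ∸ k))      ≡⟨ ∑≤-cong n term≡ ⟩
  ∑≤ n (λ k → ℕ→ℚ (n C k) * coeffFrac N k * E N k * Ê M (n ∸ k))  ∎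
  where
  open ≡-Reasoning
  a = hgSeriesE N
  b = invCoeff a
  b̂ = invCoeff (hgSeriesÊ M)
  c = 1 ÷ℕ (2 ℕ.* N)
  D : Series
  D k = b k - c * θ b k
  b²≡D⋆b̂ : (b ⋆ b) n ≡ (D ⋆ b̂) n
  b²≡D⋆b̂ = Inverse.b²≡[b-cθb]⋆b̂ (a⋆invCoeff-a≡δ a (factorialRatio-0 (2 ℕ.* N))) c
             (hgSeriesÊ≡hgSeriesE+θ M) (a⋆invCoeff-a≡δ (hgSeriesÊ M) (factorialRatio-0 (2 ℕ.* M ℕ.+ 1))) n
  term≡ : ∀ k → ℕ→ℚ (n C k) * (ℕ→ℚ (k !) * D k) * Ê M (n ∸ k) ≡ ℕ→ℚ (n C k) * coeffFrac N k * E N k * Ê M (n ∸ k)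
  term≡ k = trans (cong (λ t → ℕ→ℚ (n C k) * (ℕ→ℚ (k !) * t) * Ê M (n ∸ k)) (sym (coeffFrac-* N k (b k))))
    (solve 5 (λ C I f u v → C :* (I :* (f :* u)) :* v := C :* f :* (I :* u) :* v) refl
       (ℕ→ℚ (n C k)) (ℕ→ℚ (k !)) (coeffFrac N k) (b k) (Ê M (n ∸ k)))
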